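{- For every integer $n\ge 3$, $fw(1\,2\ldots n\;2\,3\ldots n\;2\;1)=4$.
   Context: Sequences are written as concatenations of letters. A sequence $s$ contains $u$ if some (not necessarily contiguous) subsequence of $s$ can be changed into $u$ by a one-to-one renaming of letters. An $(r,s)$-formation is a concatenation of $s$ permutations, each of the same set of $r$ distinct letters. The formation width $fw(u)$ is the minimum $s$ such that there exists $r$ for which every $(r,s)$-formation contains $u$. -}

module Defs where

open import Data.Nat using (ℕ; suc; _+_; _∸_; _<_)
open import Data.List using (List; []; _∷_; _++_; map; upTo; length; concat)
open import Data.List.Membership.Propositional using (_∈_)
open import Data.List.Relation.Binary.Sublist.Propositional using (_⊆_)
open import Data.List.Relation.Binary.Permutation.Propositional using (_↭_)
open import Data.List.Relation.Unary.All using (All)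
open import Data.List.Relation.Unary.Unique.Propositional using (Unique)
open import Data.Product using (Σ; ∃; _×_)
open import Relation.Binary.PropositionalEquality using (_≡_)
open import Relation.Nullary using (¬_)

Seq : Set
Seq = List ℕ

-- s contains u: some (not necessarily contiguous) subsequence t of s
-- becomes u under a renaming φ that is one-to-one on the letters of t.
Contains : Seq → Seq → Set
Contains s u =
  Σ Seq λ t → (t ⊆ s) ×
    Σ (ℕ → ℕ) λ φ →
      (∀ {a b} → a ∈ t → b ∈ t → φ a ≡ φ b → a ≡ b) × (map φ t ≡ u)

IsFormation : ℕ → ℕ → Seq → Set
IsFormation r s f =
  Σ Seq λ L → Unique L × (length L ≡ r) ×
    Σ (List Seq) λ ps → (length ps ≡ s) × All (_↭ L) ps × (f ≡ concat ps)

Forces : Seq → ℕ → Set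
Forces u s = ∃ λ r → ∀ f → IsFormation r s f → Contains f u

FW≡ : Seq → ℕ → Set
FW≡ u m = Forces u m × (∀ s → s < m → ¬ Forces u s)

pat : ℕ → Seq
pat n = map suc (upTo n) ++ map (2 +_) (upTo (n ∸ 1)) ++ (2 ∷ 1 ∷ [])

-- Lower bound: three ascending copies of 1 … r avoid the pattern, because its
-- subsequence a b b b a has at least four maximal ascending runs while every
-- subsequence of a concatenation of s ascending lists has at most s.
--
-- Upper bound: iterating the Erdős–Szekeres argument three times inside the
-- first block P₁ of a (r,4)-formation, for r large, yields n + 1 letters that
-- appear in the same or in the reverse order in each of P₂, P₃ and P₄.  Up to
-- reversing those letters, one of four splittings of
--   pat = 1 2 M 2 M 2 1,   M = 3 … n,
-- over the four blocks then embeds the pattern, the only non-obvious one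
-- listing the letters in the order 3 … n 2 1.
module Submission where

open import Defs
open import Data.Nat using (ℕ; zero; suc; _+_; _≤_; _<_; z≤n; s≤s; _≟_; _<?_; _≤?_)
open import Data.Nat.Properties
open import Data.Nat.GeneralisedArithmetic using (iterate)
open import Data.List using (List; []; _∷_; _++_; map; concat; replicate; reverse; filter; take; length; upTo; applyUpTo)
open import Data.List.Properties using (map-++; ++-assoc; ++-identityʳ; map-∘; map-id-local; map-applyUpTo; map-upTo; applyUpTo-∷ʳ; unfold-reverse; reverse-map; reverse-involutive; length-reverse; length-take; length-replicate; length-upTo)
open import Data.List.Membership.Propositional using (_∈_)
open import Data.List.Membership.Propositional.Properties using (∈-map⁺; ∈-++⁻; ∈-∃++; ∈-filter⁻)
open import Data.List.Membership.DecPropositional _≟_ using (_∈?_; _∉?_)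
open import Data.List.Relation.Unary.Any using (here; there)
import Data.List.Relation.Unary.Any.Properties as Any
open import Data.List.Relation.Unary.All using (All; []; _∷_)
import Data.List.Relation.Unary.All as All
import Data.List.Relation.Unary.All.Properties as All
open import Data.List.Relation.Unary.AllPairs using (AllPairs; []; _∷_)
import Data.List.Relation.Unary.AllPairs.Properties as AllPairs
open import Data.List.Relation.Unary.Unique.Propositional using (Unique)
import Data.List.Relation.Unary.Unique.Propositional.Properties as Unique
open import Data.List.Relation.Binary.Pointwise as Pointwise using (Pointwise; []; _∷_; ≡⇒Pointwise-≡)
open import Data.List.Relation.Binary.Sublist.Propositional using (_⊆_; []; _∷_; _∷ʳ_; ⊆-refl; ⊆-trans; minimum; from∈)
open import Data.List.Relation.Binary.Sublist.Propositional.Properties using (map⁺; ++⁺; ++⁺ˡ; ++⁺ʳ; reverse⁺; All-resp-⊆; Any-resp-⊆; filter-⊆; take-⊆)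
open import Data.List.Relation.Binary.Subset.Propositional using () renaming (_⊆_ to _⊆ˢ_)
open import Data.List.Relation.Binary.Subset.Propositional.Properties using (⊆-reflexive-↭)
open import Data.List.Relation.Binary.Permutation.Propositional using (_↭_; ↭-refl; ↭-sym; ↭-trans; ↭⇒↭ₛ)
open import Data.List.Relation.Binary.Permutation.Propositional.Properties using (↭-length; ↭-reverse)
open import Data.List.Relation.Binary.Permutation.Setoid.Properties using (Unique-resp-↭)
open import Data.Product using (∃; ∃₂; _×_; _,_; proj₂)
open import Data.Sum using (_⊎_; inj₁; inj₂)
open import Data.Empty using (⊥-elim)
open import Function using (_∘_; id)
open import Level using (Level)
open import Relation.Binary.Core using (Rel)
open import Relation.Binary.PropositionalEquality using (_≡_; _≢_; refl; sym; trans; cong; cong₂; subst; setoid; module ≡-Reasoning)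
open import Relation.Nullary using (¬_; Dec; yes; no; contradiction)
open import Relation.Unary using (Pred; Decidable)
open import Relation.Unary.Properties using (∁?)

private
  variable
    ℓ : Level
    A B : Set

AllPairs-resp-⊇ : ∀ {R : Rel A ℓ} {xs ys} → xs ⊆ ys → AllPairs R ys → AllPairs R xs
AllPairs-resp-⊇ []         []       = []
AllPairs-resp-⊇ (y ∷ʳ p)   (_ ∷ rs) = AllPairs-resp-⊇ p rs
AllPairs-resp-⊇ (refl ∷ p) (r ∷ rs) = All-resp-⊆ p r ∷ AllPairs-resp-⊇ p rs

unique-↭ : ∀ {xs ys : List A} → xs ↭ ys → Unique xs → Unique ys
unique-↭ p = Unique-resp-↭ (setoid _) (↭⇒↭ₛ p)

⊆-++⁻ : ∀ (xs : List A) {ys w} → w ⊆ xs ++ ys →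
        ∃₂ λ w₁ w₂ → w ≡ w₁ ++ w₂ × w₁ ⊆ xs × w₂ ⊆ ys
⊆-++⁻ []       p        = [] , _ , refl , [] , p
⊆-++⁻ (x ∷ xs) (x ∷ʳ p) with w₁ , w₂ , refl , p₁ , p₂ ← ⊆-++⁻ xs p =
  w₁ , w₂ , refl , x ∷ʳ p₁ , p₂
⊆-++⁻ (x ∷ xs) (refl ∷ p) with w₁ , w₂ , refl , p₁ , p₂ ← ⊆-++⁻ xs p =
  x ∷ w₁ , w₂ , refl , refl ∷ p₁ , p₂

⊆-map⁻ : ∀ (f : A → B) xs {ys} → ys ⊆ map f xs → ∃ λ zs → zs ⊆ xs × map f zs ≡ ys
⊆-map⁻ f []       []            = [] , [] , refl
⊆-map⁻ f (x ∷ xs) (.(f x) ∷ʳ p) with zs , q , refl ← ⊆-map⁻ f xs p = zs , x ∷ʳ q , refl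
⊆-map⁻ f (x ∷ xs) (refl ∷ p)    with zs , q , refl ← ⊆-map⁻ f xs p = x ∷ zs , refl ∷ q , refl

map-concat⁺ : ∀ (f : A → B) {Us Ps} → Pointwise (λ U P → map f U ⊆ P) Us Ps →
              map f (concat Us) ⊆ concat Ps
map-concat⁺ f []                = []
map-concat⁺ f {U ∷ Us} (p ∷ ps) =
  subst (_⊆ _) (sym (map-++ f U (concat Us))) (++⁺ p (map-concat⁺ f ps))

applyUpTo-⊆ : ∀ (f : ℕ → A) {m n} → m ≤ n → applyUpTo f m ⊆ applyUpTo f n
applyUpTo-⊆ f {zero}  _         = minimum _
applyUpTo-⊆ f {suc m} (s≤s m≤n) = refl ∷ applyUpTo-⊆ (f ∘ suc) m≤n

length-filter-∁ : ∀ {P : Pred A ℓ} (P? : Decidable P) xs →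
                  length (filter P? xs) + length (filter (∁? P?) xs) ≡ length xs
length-filter-∁ P? []       = refl
length-filter-∁ P? (x ∷ xs) with P? x
... | yes _ = cong suc (length-filter-∁ P? xs)
... | no  _ = trans (+-suc _ _) (cong suc (length-filter-∁ P? xs))

≤-+-split : ∀ a b {c d} → a + b ≤ c + d → a ≤ c ⊎ b ≤ d
≤-+-split a b {c} {d} h with a ≤? c
... | yes a≤c = inj₁ a≤c
... | no  a≰c = inj₂ (+-cancelˡ-≤ c b d (≤-trans (+-monoˡ-≤ b (<⇒≤ (≰⇒> a≰c))) h))

-- Indexing from 0, with the junk value 0 out of range.

infixl 9 _!!_
_!!_ : List ℕ → ℕ → ℕ
[]       !! _     = 0
(x ∷ xs) !! zero  = x
(x ∷ xs) !! suc i = xs !! i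

!!-∈ : ∀ xs {i} → i < length xs → xs !! i ∈ xs
!!-∈ (x ∷ xs) {zero}  _         = here refl
!!-∈ (x ∷ xs) {suc i} (s≤s i<n) = there (!!-∈ xs i<n)

!!-injective : ∀ {xs i j} → Unique xs → i < length xs → j < length xs → xs !! i ≡ xs !! j → i ≡ j
!!-injective {x ∷ xs} {zero}  {zero}  _         _         _         _ = refl
!!-injective {x ∷ xs} {zero}  {suc j} (x∉ ∷ _) _         (s≤s j<n) e = ⊥-elim (All.lookup x∉ (!!-∈ xs j<n) e)
!!-injective {x ∷ xs} {suc i} {zero}  (x∉ ∷ _) (s≤s i<n) _         e = ⊥-elim (All.lookup x∉ (!!-∈ xs i<n) (sym e))
!!-injective {x ∷ xs} {suc i} {suc j} (_ ∷ u)  (s≤s i<n) (s≤s j<n) e = cong suc (!!-injective u i<n j<n e)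

map-!!-upTo : ∀ xs → map (xs !!_) (upTo (length xs)) ≡ xs
map-!!-upTo []       = refl
map-!!-upTo (x ∷ xs) = cong (x ∷_) (begin
  map ((x ∷ xs) !!_) (applyUpTo suc (length xs)) ≡⟨ map-applyUpTo suc _ (length xs) ⟩
  applyUpTo (xs !!_) (length xs)                 ≡⟨ map-upTo (xs !!_) (length xs) ⟨
  map (xs !!_) (upTo (length xs))                ≡⟨ map-!!-upTo xs ⟩
  xs                                             ∎)
  where open ≡-Reasoning

!!-⊆ : ∀ {xs l I} → length xs ≡ l → I ⊆ upTo l → map (xs !!_) I ⊆ xs
!!-⊆ {xs} refl I⊆ = subst (map (xs !!_) _ ⊆_) (map-!!-upTo xs) (map⁺ (xs !!_) I⊆)

Contains-resp-⊇ : ∀ {F u v} → v ⊆ u → Contains F u → Contains F v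
Contains-resp-⊇ v⊆u (t , t⊆F , φ , φ-inj , refl) with t′ , t′⊆t , refl ← ⊆-map⁻ φ t v⊆u =
  t′ , ⊆-trans t′⊆t t⊆F , φ ,
  (λ a∈ b∈ → φ-inj (Any-resp-⊆ t′⊆t a∈) (Any-resp-⊆ t′⊆t b∈)) , refl

preimage : (ℕ → ℕ) → List ℕ → ℕ → ℕ
preimage ψ []      y = 0
preimage ψ (p ∷ u) y with ψ p ≟ y
... | yes _ = p
... | no  _ = preimage ψ u y

preimage-∈ : ∀ ψ u {y} → y ∈ map ψ u → preimage ψ u y ∈ u × ψ (preimage ψ u y) ≡ y
preimage-∈ ψ (p ∷ u) {y} y∈ with ψ p ≟ y | y∈
... | yes e | _         = here refl , e
... | no ne | here e    = ⊥-elim (ne (sym e))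
... | no _  | there y∈′ with q∈ , e ← preimage-∈ ψ u y∈′ = there q∈ , e

contains-injective-image : ∀ {F u} (ψ : ℕ → ℕ) → (∀ {p q} → p ∈ u → q ∈ u → ψ p ≡ ψ q → p ≡ q) →
                           map ψ u ⊆ F → Contains F u
contains-injective-image {u = u} ψ ψ-inj ψu⊆F =
  map ψ u , ψu⊆F , preimage ψ u , φ-inj ,
  trans (sym (map-∘ u)) (map-id-local (All.tabulate retract))
  where
    φ-inj : ∀ {a b} → a ∈ map ψ u → b ∈ map ψ u → preimage ψ u a ≡ preimage ψ u b → a ≡ b
    φ-inj a∈ b∈ e =
      trans (sym (proj₂ (preimage-∈ ψ u a∈))) (trans (cong ψ e) (proj₂ (preimage-∈ ψ u b∈)))
    retract : ∀ {p} → p ∈ u → preimage ψ u (ψ p) ≡ p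
    retract p∈ with q∈ , ψq≡ψp ← preimage-∈ ψ u (∈-map⁺ ψ p∈) = ψ-inj q∈ p∈ ψq≡ψp

-- Ascending runs

countUnless : ∀ {P : Set} → Dec P → ℕ → ℕ
countUnless (yes _) n = n
countUnless (no  _) n = suc n

runs : List ℕ → ℕ
runs []               = 0
runs (x ∷ [])         = 1
runs (x ∷ xs@(y ∷ _)) = countUnless (x <? y) (runs xs)

countUnless-yes : ∀ {P : Set} {n} (d : Dec P) → P → countUnless d n ≡ n
countUnless-yes (yes _) _ = refl
countUnless-yes (no ¬p) p = contradiction p ¬p

countUnless-no : ∀ {P : Set} {n} (d : Dec P) → ¬ P → countUnless d n ≡ suc n
countUnless-no (yes p) ¬p = contradiction p ¬p
countUnless-no (no  _) _  = refl

countUnless-≤ : ∀ {P : Set} {n} (d : Dec P) → countUnless d n ≤ suc n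
countUnless-≤ (yes _) = n≤1+n _
countUnless-≤ (no  _) = ≤-refl

countUnless-≥ : ∀ {P : Set} {n} (d : Dec P) → n ≤ countUnless d n
countUnless-≥ (yes _) = ≤-refl
countUnless-≥ (no  _) = n≤1+n _

countUnless-mono : ∀ {P : Set} {m n k} (d : Dec P) → m ≤ n + k → countUnless d m ≤ countUnless d n + k
countUnless-mono (yes _) m≤ = m≤
countUnless-mono (no  _) m≤ = s≤s m≤

runs-positive : ∀ x xs → 1 ≤ runs (x ∷ xs)
runs-positive x []       = ≤-refl
runs-positive x (y ∷ xs) = ≤-trans (runs-positive y xs) (countUnless-≥ (x <? y))

runs-∷ : ∀ x xs → runs (x ∷ xs) ≤ suc (runs xs)
runs-∷ x []       = ≤-refl
runs-∷ x (y ∷ xs) = countUnless-≤ (x <? y)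

runs-++ : ∀ xs ys → runs (xs ++ ys) ≤ runs xs + runs ys
runs-++ []               ys = ≤-refl
runs-++ (x ∷ [])         ys = runs-∷ x ys
runs-++ (x ∷ xs@(y ∷ _)) ys = countUnless-mono (x <? y) (runs-++ xs ys)

runs-ascending : ∀ {xs} → AllPairs _<_ xs → runs xs ≤ 1
runs-ascending {[]}         _                 = z≤n
runs-ascending {x ∷ []}     _                 = ≤-refl
runs-ascending {x ∷ y ∷ xs} ((x<y ∷ _) ∷ asc) =
  ≤-trans (≤-reflexive (countUnless-yes (x <? y) x<y)) (runs-ascending asc)

runs-⊆-concat : ∀ {Rs w} → All (AllPairs _<_) Rs → w ⊆ concat Rs → runs w ≤ length Rs
runs-⊆-concat []             [] = z≤n
runs-⊆-concat {R ∷ Rs} (asc ∷ ascs) w⊆ with w₁ , w₂ , refl , w₁⊆ , w₂⊆ ← ⊆-++⁻ R w⊆ =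
  ≤-trans (runs-++ w₁ w₂) (+-mono-≤ (runs-ascending (AllPairs-resp-⊇ w₁⊆ asc)) (runs-⊆-concat ascs w₂⊆))

runs-abbba : ∀ a b → 4 ≤ runs (a ∷ b ∷ b ∷ b ∷ a ∷ [])
runs-abbba a b
  rewrite countUnless-no {n = runs (b ∷ b ∷ a ∷ [])} (b <? b) (<-irrefl refl)
        | countUnless-no {n = runs (b ∷ a ∷ [])} (b <? b) (<-irrefl refl)
  with a <? b
... | yes a<b rewrite countUnless-no {n = 1} (b <? a) (<-asym a<b) = ≤-refl
... | no  _   = s≤s (s≤s (s≤s (runs-positive b (a ∷ []))))

middle : ℕ → Seq
middle m = applyUpTo (3 +_) m

pat-shape : ∀ m → pat (2 + m) ≡ 1 ∷ 2 ∷ middle m ++ 2 ∷ middle m ++ 2 ∷ 1 ∷ []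
pat-shape m = cong₂ (λ M M′ → 1 ∷ 2 ∷ M ++ 2 ∷ M′ ++ 2 ∷ 1 ∷ [])
  (map-applyUpTo (2 +_) suc m) (map-applyUpTo suc (2 +_) m)

data Letter (m : ℕ) : ℕ → Set where
  one : Letter m 1
  two : Letter m 2
  mid : ∀ {i} → i < m → Letter m (3 + i)

pat-letter : ∀ m {p} → p ∈ pat (2 + m) → Letter m p
pat-letter m {p} p∈ = All.lookup letters (subst (p ∈_) (pat-shape m) p∈)
  where
    mids : All (Letter m) (middle m)
    mids = All.applyUpTo⁺₁ (3 +_) m mid
    letters : All (Letter m) (1 ∷ 2 ∷ middle m ++ 2 ∷ middle m ++ 2 ∷ 1 ∷ [])
    letters = one ∷ two ∷ All.++⁺ mids (two ∷ All.++⁺ mids (two ∷ one ∷ []))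

abbba⊆pat : ∀ m → 1 ∷ 2 ∷ 2 ∷ 2 ∷ 1 ∷ [] ⊆ pat (2 + m)
abbba⊆pat m = subst (1 ∷ 2 ∷ 2 ∷ 2 ∷ 1 ∷ [] ⊆_) (sym (pat-shape m))
  (refl ∷ refl ∷ ++⁺ˡ (middle m) (refl ∷ ++⁺ˡ (middle m) (refl ∷ refl ∷ [])))

abbba-occurrence : ∀ {F} → Contains F (1 ∷ 2 ∷ 2 ∷ 2 ∷ 1 ∷ []) → ∃₂ λ a b → a ∷ b ∷ b ∷ b ∷ a ∷ [] ⊆ F
abbba-occurrence (t , t⊆F , φ , φ-inj , φt≡)
  with e₁ ∷ e₂ ∷ e₃ ∷ e₄ ∷ e₅ ∷ [] ← Pointwise.map⁻ {ys = 1 ∷ 2 ∷ 2 ∷ 2 ∷ 1 ∷ []} φ id (≡⇒Pointwise-≡ φt≡)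
  with refl ← φ-inj (there (here refl)) (there (there (here refl))) (trans e₂ (sym e₃))
  with refl ← φ-inj (there (there (here refl))) (there (there (there (here refl)))) (trans e₃ (sym e₄))
  with refl ← φ-inj (here refl) (there (there (there (there (here refl))))) (trans e₁ (sym e₅))
  = _ , _ , t⊆F

ascending-formation : ∀ r s → IsFormation r s (concat (replicate s (upTo r)))
ascending-formation r s =
  upTo r , Unique.upTo⁺ r , length-upTo r ,
  replicate s (upTo r) , length-replicate s , All.replicate⁺ s ↭-refl , refl

upTo-ascending : ∀ r → AllPairs _<_ (upTo r)
upTo-ascending r = AllPairs.applyUpTo⁺₁ id r (λ i<j _ → i<j)

pat-not-forced : ∀ m s → s < 4 → ¬ Forces (pat (2 + m)) s
pat-not-forced m s s<4 (r , forces)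
  with a , b , abbba⊆ ← abbba-occurrence (Contains-resp-⊇ (abbba⊆pat m) (forces _ (ascending-formation r s)))
  = <⇒≱ s<4 (begin
    4                              ≤⟨ runs-abbba a b ⟩
    runs (a ∷ b ∷ b ∷ b ∷ a ∷ [])  ≤⟨ runs-⊆-concat (All.replicate⁺ s (upTo-ascending r)) abbba⊆ ⟩
    length (replicate s (upTo r))  ≡⟨ length-replicate s ⟩
    s                              ∎)
  where open ≤-Reasoning

-- Monotone subsequences

esBound : ℕ → ℕ → ℕ
esBound zero    _       = 0
esBound (suc a) zero    = 0
esBound (suc a) (suc b) = suc (esBound (suc a) b + esBound a (suc b))

HasMonotone : ℕ → ℕ → Seq → Seq → Set
HasMonotone a b S Q =
  ∃ λ S′ → S′ ⊆ S × (length S′ ≡ a × S′ ⊆ Q ⊎ length S′ ≡ b × reverse S′ ⊆ Q)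

HasMonotone-resp-⊆ : ∀ {a b S T Q} → S ⊆ T → HasMonotone a b S Q → HasMonotone a b T Q
HasMonotone-resp-⊆ S⊆T (S′ , S′⊆S , mono) = S′ , ⊆-trans S′⊆S S⊆T , mono

extend-before : ∀ {a b x S Q₁ Q₂} → HasMonotone (suc a) b S Q₁ →
                HasMonotone (suc a) (suc b) (x ∷ S) (Q₁ ++ x ∷ Q₂)
extend-before {x = x} {Q₂ = Q₂} (S′ , s , inj₁ (l , q)) = S′ , x ∷ʳ s , inj₁ (l , ++⁺ʳ (x ∷ Q₂) q)
extend-before {x = x} {Q₂ = Q₂} (S′ , s , inj₂ (l , q)) =
  x ∷ S′ , refl ∷ s , inj₂ (cong suc l , subst (_⊆ _) (sym (unfold-reverse x S′)) (++⁺ q (refl ∷ minimum Q₂)))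

extend-after : ∀ {a b x S Q₁ Q₂} → HasMonotone a (suc b) S Q₂ →
               HasMonotone (suc a) (suc b) (x ∷ S) (Q₁ ++ x ∷ Q₂)
extend-after {x = x} {Q₁ = Q₁} (S′ , s , inj₁ (l , q)) = x ∷ S′ , refl ∷ s , inj₁ (cong suc l , ++⁺ˡ Q₁ (refl ∷ q))
extend-after {x = x} {Q₁ = Q₁} (S′ , s , inj₂ (l , q)) = S′ , x ∷ʳ s , inj₂ (l , ++⁺ˡ Q₁ (x ∷ʳ q))

filter-∉-⊆ˢ : ∀ {x S Q₁ Q₂} → All (x ≢_) S → S ⊆ˢ Q₁ ++ x ∷ Q₂ → filter (_∉? Q₁) S ⊆ˢ Q₂
filter-∉-⊆ˢ {Q₁ = Q₁} x∉S S⊆Q y∈ with y∈S , y∉Q₁ ← ∈-filter⁻ (_∉? Q₁) y∈ with ∈-++⁻ Q₁ (S⊆Q y∈S)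
... | inj₁ y∈Q₁         = contradiction y∈Q₁ y∉Q₁
... | inj₂ (here y≡x)   = contradiction (sym y≡x) (All.lookup x∉S y∈S)
... | inj₂ (there y∈Q₂) = y∈Q₂

-- Split Q around the first letter x of S: the rest of S lies before or after x.
erdős-szekeres : ∀ a b {S Q} → Unique S → S ⊆ˢ Q → esBound a b ≤ length S → HasMonotone a b S Q
erdős-szekeres zero    b       _ _ _ = [] , minimum _ , inj₁ (refl , minimum _)
erdős-szekeres (suc a) zero    _ _ _ = [] , minimum _ , inj₂ (refl , minimum _)
erdős-szekeres (suc a) (suc b) {x ∷ S} (x∉S ∷ uS) S⊆Q (s≤s bound)
  with Q₁ , Q₂ , refl ← ∈-∃++ (S⊆Q (here refl))
  with ≤-+-split _ _ (subst (_ ≤_) (sym (length-filter-∁ (_∈? Q₁) S)) bound)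
... | inj₁ big = extend-before (HasMonotone-resp-⊆ (filter-⊆ _ S)
      (erdős-szekeres (suc a) b (Unique.filter⁺ _ uS) (λ y∈ → proj₂ (∈-filter⁻ (_∈? Q₁) {xs = S} y∈)) big))
... | inj₂ big = extend-after (HasMonotone-resp-⊆ (filter-⊆ _ S)
      (erdős-szekeres a (suc b) (Unique.filter⁺ _ uS) (filter-∉-⊆ˢ x∉S (S⊆Q ∘ there)) big))

infix 4 _⊆±_
_⊆±_ : Seq → Seq → Set
S ⊆± Q = S ⊆ Q ⊎ reverse S ⊆ Q

⊆±-resp-⊇ : ∀ {S T Q} → S ⊆ T → T ⊆± Q → S ⊆± Q
⊆±-resp-⊇ S⊆T (inj₁ T⊆Q) = inj₁ (⊆-trans S⊆T T⊆Q)
⊆±-resp-⊇ S⊆T (inj₂ T⊆Q) = inj₂ (⊆-trans (reverse⁺ S⊆T) T⊆Q)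

⊆±⇒⊆ˢ : ∀ {S Q} → S ⊆± Q → S ⊆ˢ Q
⊆±⇒⊆ˢ (inj₁ S⊆Q) x∈ = Any-resp-⊆ S⊆Q x∈
⊆±⇒⊆ˢ (inj₂ S⊆Q) x∈ = Any-resp-⊆ S⊆Q (Any.reverse⁺ x∈)

reverse-⊆ˢ : ∀ {S Q : Seq} → S ⊆ Q → reverse S ⊆ˢ Q
reverse-⊆ˢ {S} S⊆Q x∈ = Any-resp-⊆ S⊆Q (Any.reverse⁻ {xs = S} x∈)

monotone-subsequence : ∀ m {S Q} → Unique S → S ⊆ˢ Q → esBound m m ≤ length S →
                       ∃ λ S′ → S′ ⊆ S × length S′ ≡ m × S′ ⊆± Q
monotone-subsequence m uS S⊆Q bound with erdős-szekeres m m uS S⊆Q bound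
... | S′ , S′⊆S , inj₁ (l , o) = S′ , S′⊆S , l , inj₁ o
... | S′ , S′⊆S , inj₂ (l , o) = S′ , S′⊆S , l , inj₂ o

monotone-subsequence-in-all : ∀ m Ps {S} → Unique S → All (S ⊆ˢ_) Ps →
                              iterate (λ k → esBound k k) m (length Ps) ≤ length S →
                              ∃ λ S′ → S′ ⊆ S × length S′ ≡ m × All (S′ ⊆±_) Ps
monotone-subsequence-in-all m [] {S} _ _ m≤ =
  take m S , take-⊆ m S , trans (length-take m S) (m≤n⇒m⊓n≡m m≤) , []
monotone-subsequence-in-all m (P ∷ Ps) uS (S⊆P ∷ S⊆Ps) bound
  with S₁ , S₁⊆S , l₁ , mono₁ ← monotone-subsequence-in-all (esBound m m) Ps uS S⊆Ps bound
  with S′ , S′⊆S₁ , l , o ← monotone-subsequence m (AllPairs-resp-⊇ S₁⊆S uS)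
                              (λ x∈ → S⊆P (Any-resp-⊆ S₁⊆S x∈)) (≤-reflexive (sym l₁))
  = S′ , ⊆-trans S′⊆S₁ S₁⊆S , l , o ∷ All.map (⊆±-resp-⊇ S′⊆S₁) mono₁

letter-< : ∀ {m p} → Letter m p → p < 3 + m
letter-< one       = s≤s (s≤s z≤n)
letter-< two       = s≤s (s≤s (s≤s z≤n))
letter-< (mid i<m) = +-monoʳ-< 3 i<m

-- The index, counted from 1, of letter p in the order 3 … n 2 1, n = 2 + m.
reorder : ℕ → ℕ → ℕ
reorder m 0                   = 0
reorder m 1                   = 2 + m
reorder m 2                   = 1 + m
reorder m (suc (suc (suc i))) = suc i

reorder-< : ∀ {m p} → Letter m p → reorder m p < 3 + m
reorder-< {m} one   = n<1+n (2 + m)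
reorder-< {m} two   = m<n⇒m<1+n (n<1+n (1 + m))
reorder-< (mid i<m) = s≤s (m<n⇒m<1+n (m<n⇒m<1+n i<m))

reorder-injective : ∀ {m p q} → Letter m p → Letter m q → reorder m p ≡ reorder m q → p ≡ q
reorder-injective one       one       _ = refl
reorder-injective two       two       _ = refl
reorder-injective (mid _)   (mid _)   e = cong (2 +_) e
reorder-injective {m} one   two       e = contradiction (sym e) (<⇒≢ (n<1+n (1 + m)))
reorder-injective {m} two   one       e = contradiction e (<⇒≢ (n<1+n (1 + m)))
reorder-injective one       (mid j<m) e = contradiction (sym e) (<⇒≢ (s≤s (m<n⇒m<1+n j<m)))
reorder-injective (mid i<m) one       e = contradiction e (<⇒≢ (s≤s (m<n⇒m<1+n i<m)))
reorder-injective two       (mid j<m) e = contradiction (sym e) (<⇒≢ (s≤s j<m))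
reorder-injective (mid i<m) two       e = contradiction e (<⇒≢ (s≤s i<m))

module PatternIn {m : ℕ} {Q : Seq} (uQ : Unique Q) (lQ : length Q ≡ 3 + m) where

  M : Seq
  M = middle m

  ascending : ∀ {I P} → I ⊆ upTo (3 + m) → Q ⊆ P → map (Q !!_) I ⊆ P
  ascending I⊆ Q⊆P = ⊆-trans (!!-⊆ {Q} lQ I⊆) Q⊆P

  descending : ∀ {I P} → reverse I ⊆ upTo (3 + m) → reverse Q ⊆ P → map (Q !!_) I ⊆ P
  descending {I} rI⊆ rQ⊆P =
    ⊆-trans (subst (_⊆ reverse Q) reverse-map-reverse (reverse⁺ (!!-⊆ {Q} lQ rI⊆))) rQ⊆P
    where
      reverse-map-reverse : reverse (map (Q !!_) (reverse I)) ≡ map (Q !!_) I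
      reverse-map-reverse =
        trans (cong reverse (reverse-map (Q !!_) I)) (reverse-involutive (map (Q !!_) I))

  single : ∀ {i P} → i < 3 + m → Q ⊆ˢ P → Q !! i ∷ [] ⊆ P
  single i< Q⊆P = from∈ (Q⊆P (!!-∈ Q (subst (_ <_) (sym lQ) i<)))

  by-pieces : (σ : ℕ → ℕ) → (∀ {p q} → Letter m p → Letter m q → σ p ≡ σ q → p ≡ q) →
              (∀ {p} → Letter m p → σ p < 3 + m) →
              ∀ Us {Ps} → pat (2 + m) ≡ concat Us → Pointwise (λ U P → map ((Q !!_) ∘ σ) U ⊆ P) Us Ps →
              Contains (concat Ps) (pat (2 + m))
  by-pieces σ σ-inj σ-< Us pat≡ pieces =
    contains-injective-image ((Q !!_) ∘ σ) ψ-inj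
      (subst (λ u → map ((Q !!_) ∘ σ) u ⊆ _) (sym pat≡) (map-concat⁺ ((Q !!_) ∘ σ) pieces))
    where
      index-< : ∀ {p} → Letter m p → σ p < length Q
      index-< L = subst (_ <_) (sym lQ) (σ-< L)
      ψ-inj : ∀ {p q} → p ∈ pat (2 + m) → q ∈ pat (2 + m) → Q !! σ p ≡ Q !! σ q → p ≡ q
      ψ-inj p∈ q∈ e =
        σ-inj (pat-letter m p∈) (pat-letter m q∈)
          (!!-injective uQ (index-< (pat-letter m p∈)) (index-< (pat-letter m q∈)) e)

  -- In the names, the block Pᵢ contains the letters of Q in order (↑), in
  -- reverse order (↓), or at least as a set (∈).
  embed-↑↑∈∈ : ∀ {P₁ P₂ P₃ P₄} → Q ⊆ P₁ → Q ⊆ P₂ → Q ⊆ˢ P₃ → Q ⊆ˢ P₄ →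
               Contains (concat (P₁ ∷ P₂ ∷ P₃ ∷ P₄ ∷ [])) (pat (2 + m))
  embed-↑↑∈∈ q₁ q₂ q₃ q₄ =
    by-pieces id (λ _ _ e → e) letter-<
      ((1 ∷ 2 ∷ M) ∷ (2 ∷ M) ∷ (2 ∷ []) ∷ (1 ∷ []) ∷ []) (pat-shape m)
      (ascending (0 ∷ʳ ⊆-refl) q₁ ∷ ascending (0 ∷ʳ 1 ∷ʳ ⊆-refl) q₂ ∷
       single (letter-< two) q₃ ∷ single (letter-< one) q₄ ∷ [])

  embed-∈↑↑↓ : ∀ {P₁ P₂ P₃ P₄} → Q ⊆ˢ P₁ → Q ⊆ P₂ → Q ⊆ P₃ → reverse Q ⊆ P₄ →
               Contains (concat (P₁ ∷ P₂ ∷ P₃ ∷ P₄ ∷ [])) (pat (2 + m))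
  embed-∈↑↑↓ q₁ q₂ q₃ q₄ =
    by-pieces id (λ _ _ e → e) letter-<
      ((1 ∷ []) ∷ (2 ∷ M) ∷ (2 ∷ M) ∷ (2 ∷ 1 ∷ []) ∷ []) (pat-shape m)
      (single (letter-< one) q₁ ∷ ascending (0 ∷ʳ 1 ∷ʳ ⊆-refl) q₂ ∷
       ascending (0 ∷ʳ 1 ∷ʳ ⊆-refl) q₃ ∷ descending (0 ∷ʳ refl ∷ refl ∷ minimum _) q₄ ∷ [])

  embed-↑∈↑↓ : ∀ {P₁ P₂ P₃ P₄} → Q ⊆ P₁ → Q ⊆ˢ P₂ → Q ⊆ P₃ → reverse Q ⊆ P₄ →
               Contains (concat (P₁ ∷ P₂ ∷ P₃ ∷ P₄ ∷ [])) (pat (2 + m))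
  embed-↑∈↑↓ q₁ q₂ q₃ q₄ =
    by-pieces id (λ _ _ e → e) letter-<
      ((1 ∷ 2 ∷ M) ∷ (2 ∷ []) ∷ M ∷ (2 ∷ 1 ∷ []) ∷ []) (pat-shape m)
      (ascending (0 ∷ʳ ⊆-refl) q₁ ∷ single (letter-< two) q₂ ∷
       ascending (0 ∷ʳ 1 ∷ʳ 2 ∷ʳ ⊆-refl) q₃ ∷ descending (0 ∷ʳ refl ∷ refl ∷ minimum _) q₄ ∷ [])

  embed-∈∈↑↑ : ∀ {P₁ P₂ P₃ P₄} → Q ⊆ˢ P₁ → Q ⊆ˢ P₂ → Q ⊆ P₃ → Q ⊆ P₄ →
               Contains (concat (P₁ ∷ P₂ ∷ P₃ ∷ P₄ ∷ [])) (pat (2 + m))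
  embed-∈∈↑↑ q₁ q₂ q₃ q₄ =
    by-pieces (reorder m) reorder-injective reorder-<
      ((1 ∷ []) ∷ (2 ∷ []) ∷ (M ++ 2 ∷ []) ∷ (M ++ 2 ∷ 1 ∷ []) ∷ []) pat≡
      (single (reorder-< one) q₁ ∷ single (reorder-< two) q₂ ∷
       reordered (trans (reorder-middle []) (++-identityʳ _)) (0 ∷ʳ applyUpTo-⊆ suc (n≤1+n (suc m))) q₃ ∷
       reordered (trans (reorder-middle (1 ∷ [])) (applyUpTo-∷ʳ suc (suc m))) (0 ∷ʳ ⊆-refl) q₄ ∷ [])
    where
      open ≡-Reasoning
      pat≡ : pat (2 + m) ≡ 1 ∷ 2 ∷ (M ++ 2 ∷ []) ++ (M ++ 2 ∷ 1 ∷ []) ++ []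
      pat≡ = trans (pat-shape m) (cong (λ w → 1 ∷ 2 ∷ w) (begin
        M ++ 2 ∷ M ++ 2 ∷ 1 ∷ []                  ≡⟨ ++-assoc M (2 ∷ []) _ ⟨
        (M ++ 2 ∷ []) ++ M ++ 2 ∷ 1 ∷ []          ≡⟨ cong ((M ++ 2 ∷ []) ++_) (++-identityʳ _) ⟨
        (M ++ 2 ∷ []) ++ (M ++ 2 ∷ 1 ∷ []) ++ []  ∎))
      reorder-middle : ∀ w → map (reorder m) (M ++ 2 ∷ w) ≡ applyUpTo suc (suc m) ++ map (reorder m) w
      reorder-middle w = begin
        map (reorder m) (M ++ 2 ∷ w)                          ≡⟨ map-++ (reorder m) M (2 ∷ w) ⟩
        map (reorder m) M ++ suc m ∷ map (reorder m) w        ≡⟨ cong (_++ suc m ∷ map (reorder m) w) (map-applyUpTo (3 +_) (reorder m) m) ⟩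
        applyUpTo suc m ++ suc m ∷ map (reorder m) w          ≡⟨ ++-assoc (applyUpTo suc m) (suc m ∷ []) _ ⟨
        (applyUpTo suc m ++ suc m ∷ []) ++ map (reorder m) w  ≡⟨ cong (_++ map (reorder m) w) (applyUpTo-∷ʳ suc m) ⟩
        applyUpTo suc (suc m) ++ map (reorder m) w            ∎
      reordered : ∀ {U I P} → map (reorder m) U ≡ I → I ⊆ upTo (3 + m) → Q ⊆ P →
                  map ((Q !!_) ∘ reorder m) U ⊆ P
      reordered {U} refl I⊆ Q⊆P = subst (_⊆ _) (sym (map-∘ U)) (ascending I⊆ Q⊆P)

pat-in-monotone : ∀ {m Q P₁ P₂ P₃ P₄} → Unique Q → length Q ≡ 3 + m →
                  Q ⊆ P₁ → Q ⊆± P₂ → Q ⊆± P₃ → Q ⊆± P₄ →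
                  Contains (concat (P₁ ∷ P₂ ∷ P₃ ∷ P₄ ∷ [])) (pat (2 + m))
pat-in-monotone uQ lQ q₁ (inj₁ q₂) o₃ o₄ = embed-↑↑∈∈ q₁ q₂ (⊆±⇒⊆ˢ o₃) (⊆±⇒⊆ˢ o₄)
  where open PatternIn uQ lQ
pat-in-monotone uQ lQ q₁ (inj₂ r₂) (inj₁ q₃) (inj₁ q₄) = embed-∈∈↑↑ (Any-resp-⊆ q₁) (⊆±⇒⊆ˢ (inj₂ r₂)) q₃ q₄
  where open PatternIn uQ lQ
pat-in-monotone uQ lQ q₁ (inj₂ r₂) (inj₁ q₃) (inj₂ r₄) = embed-↑∈↑↓ q₁ (⊆±⇒⊆ˢ (inj₂ r₂)) q₃ r₄
  where open PatternIn uQ lQ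
pat-in-monotone {Q = Q} uQ lQ q₁ (inj₂ r₂) (inj₂ r₃) (inj₁ q₄) =
  embed-∈↑↑↓ (reverse-⊆ˢ q₁) r₂ r₃ (subst (_⊆ _) (sym (reverse-involutive Q)) q₄)
  where open PatternIn (unique-↭ (↭-sym (↭-reverse Q)) uQ) (trans (length-reverse Q) lQ)
pat-in-monotone {Q = Q} uQ lQ q₁ (inj₂ r₂) (inj₂ r₃) (inj₂ r₄) =
  embed-∈∈↑↑ (reverse-⊆ˢ q₁) (⊆±⇒⊆ˢ (inj₁ r₂)) r₃ r₄
  where open PatternIn (unique-↭ (↭-sym (↭-reverse Q)) uQ) (trans (length-reverse Q) lQ)

pat-in-blocks : ∀ m {P₁ P₂ P₃ P₄} → Unique P₁ → All (P₁ ⊆ˢ_) (P₂ ∷ P₃ ∷ P₄ ∷ []) →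
                iterate (λ k → esBound k k) (3 + m) 3 ≤ length P₁ →
                Contains (concat (P₁ ∷ P₂ ∷ P₃ ∷ P₄ ∷ [])) (pat (2 + m))
pat-in-blocks m uP₁ P₁⊆ bound
  with S , S⊆P₁ , lS , o₂ ∷ o₃ ∷ o₄ ∷ [] ← monotone-subsequence-in-all (3 + m) _ uP₁ P₁⊆ bound
  = pat-in-monotone (AllPairs-resp-⊇ S⊆P₁ uP₁) lS S⊆P₁ o₂ o₃ o₄

pat-forced : ∀ m → Forces (pat (2 + m)) 4
pat-forced m = iterate (λ k → esBound k k) (3 + m) 3 , contains
  where
    contains : ∀ f → IsFormation (iterate (λ k → esBound k k) (3 + m) 3) 4 f → Contains f (pat (2 + m))
    contains _ (_ , _ , _ , []                    , () , _)
    contains _ (_ , _ , _ , _ ∷ []                , () , _)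
    contains _ (_ , _ , _ , _ ∷ _ ∷ []            , () , _)
    contains _ (_ , _ , _ , _ ∷ _ ∷ _ ∷ []        , () , _)
    contains _ (_ , _ , _ , _ ∷ _ ∷ _ ∷ _ ∷ _ ∷ _ , () , _)
    contains _ (L , uL , lL , P₁ ∷ P₂ ∷ P₃ ∷ P₄ ∷ [] , refl , p₁ ∷ p₂ ∷ p₃ ∷ p₄ ∷ [] , refl) =
      pat-in-blocks m (unique-↭ (↭-sym p₁) uL) (letters-in p₂ ∷ letters-in p₃ ∷ letters-in p₄ ∷ [])
        (≤-reflexive (sym (trans (↭-length p₁) lL)))
      where
        letters-in : ∀ {P} → P ↭ L → P₁ ⊆ˢ P
        letters-in p = ⊆-reflexive-↭ (↭-trans p₁ (↭-sym p))

fw-pat : ∀ m → FW≡ (pat (2 + m)) 4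
fw-pat m = pat-forced m , pat-not-forced m

lemma7 : ∀ (n : ℕ) → 3 ≤ n → FW≡ (pat n) 4
lemma7 1             (s≤s ())
lemma7 (suc (suc m)) _ = fw-pat m
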